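{- If $(G,\sigma)$ is a signed graph, then $\chi_{\pm}((G,\sigma))-1\le\chi((G,\sigma))\le\chi_{\pm}((G,\sigma))+1$.
   Context: Graphs are simple and finite. A signed graph $(G,\sigma)$ is a graph $G$ with a map $\sigma:E(G)\to\{\pm1\}$. For $x\in\mathbb{R}$ and $r>0$, $[x]_r\in[0,r)$ is the remainder of $x$ modulo $r$ and $|x|_r=\min\{[x]_r,[-x]_r\}$. For positive integers $k\ge 2d$, a $(k,d)$-coloring of $(G,\sigma)$ is a map $c:V(G)\to\mathbb{Z}_k$ such that $|c(v)-\sigma(e)c(w)|_k\ge d$ for every edge $e=vw$; the chromatic number $\chi((G,\sigma))$ is the minimum $k$ such that $(G,\sigma)$ has a $(k,1)$-coloring. For a positive integer $n$, let $M_n=\{0,\pm1,\dots,\pm k\}\subset\mathbb{Z}$ if $n=2k+1$ and $M_n=\{\pm1,\dots,\pm k\}\subset\mathbb{Z}$ if $n=2k$. An $n$-coloring of $(G,\sigma)$ (in the sense of signed colors) is a map $c:V(G)\to M_n$ with $c(v)\ne\sigma(e)c(w)$ (as integers) for every edge $e=vw$, and $\chi_{\pm}((G,\sigma))$ is the smallest $n$ such that $(G,\sigma)$ has such an $n$-coloring. -}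

module Defs where

open import Data.Nat as ℕ using (ℕ; zero; suc; NonZero; _≤_; _⊓_)
open import Data.Integer as ℤ using (ℤ; +_; _-_; -_; ∣_∣; _%ℕ_)
open import Data.Fin using (Fin; toℕ)
open import Data.Maybe using (Maybe; just; nothing)
open import Data.Product using (Σ; _×_)
open import Data.Sum using (_⊎_)
open import Relation.Binary.PropositionalEquality using (_≡_; _≢_)

data Sign : Set where
  pos neg : Sign

_·_ : Sign → ℤ → ℤ
pos · x = x
neg · x = - x

-- A simple finite signed graph on vertex set Fin n, given by a signed
-- adjacency function: adj v w = just s iff vw is an edge with sign s.
record SignedGraph : Set where
  field
    n     : ℕ
    adj   : Fin n → Fin n → Maybe Sign
    loopless : ∀ v → adj v v ≡ nothing
    sym   : ∀ v w → adj v w ≡ adj w v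
open SignedGraph public

rem : ℤ → (r : ℕ) → .{{NonZero r}} → ℕ
rem x r = x %ℕ r

absMod : ℤ → (r : ℕ) → .{{NonZero r}} → ℕ
absMod x r = rem x r ⊓ rem (- x) r

IsKDColoring : (G : SignedGraph) (k d : ℕ) .{{_ : NonZero k}} → (Fin (n G) → Fin k) → Set
IsKDColoring G k d c =
  ∀ v w s → adj G v w ≡ just s →
    d ≤ absMod ((+ toℕ (c v)) - (s · (+ toℕ (c w)))) k

-- G has a (k,1)-coloring (with k ≥ 2d = 2, as required of (k,d)-colorings)
HasK1Coloring : SignedGraph → ℕ → Set
HasK1Coloring G zero = Data.Empty.⊥ where import Data.Empty
HasK1Coloring G (suc k) =
  (2 ℕ.≤ suc k) × Σ (Fin (n G) → Fin (suc k)) (λ c → IsKDColoring G (suc k) 1 c)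

IsChromaticNumber : SignedGraph → ℕ → Set
IsChromaticNumber G m = HasK1Coloring G m × (∀ k → HasK1Coloring G k → m ≤ k)

InM : ℕ → ℤ → Set
InM m x =
  Σ ℕ (λ k → (m ≡ suc (2 ℕ.* k)) × (∣ x ∣ ≤ k)) ⊎
  Σ ℕ (λ k → (m ≡ 2 ℕ.* k) × (x ≢ + 0) × (∣ x ∣ ≤ k))

IsSignedColoring : (G : SignedGraph) → ℕ → (Fin (n G) → ℤ) → Set
IsSignedColoring G m c =
  (∀ v → InM m (c v)) ×
  (∀ v w s → adj G v w ≡ just s → c v ≢ s · c w)

HasSignedColoring : SignedGraph → ℕ → Set
HasSignedColoring G m = (1 ≤ m) × Σ (Fin (n G) → ℤ) (IsSignedColoring G m)

IsSignedChromaticNumber : SignedGraph → ℕ → Set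
IsSignedChromaticNumber G m =
  HasSignedColoring G m × (∀ k → HasSignedColoring G k → m ≤ k)

-- A (k,1)-coloring says exactly that k does not divide c(v) - σ(e) c(w) on any edge.
-- Reading each colour in ℤ_k as its representative of least absolute value turns a
-- (k,1)-coloring into a signed (2⌊k/2⌋+1)-coloring, and 2⌊k/2⌋+1 ≤ k+1.
-- Conversely, a signed m-coloring has |c(v) - σ(e) c(w)| ≤ m on every edge, so reducing
-- it modulo m+1 keeps every edge condition and gives an (m+1,1)-coloring.
module Submission where

open import Defs
open import Data.Nat using (ℕ; _≤_; _+_)
open import Data.Product using (_×_)

open import Data.Nat as ℕ using (zero; suc; z≤n; s≤s; _<_; _∸_; NonZero; ⌊_/2⌋; ⌈_/2⌉)
import Data.Nat.Properties as ℕ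
open import Data.Nat.Divisibility using (>⇒∤)
open import Data.Integer as ℤ using (ℤ; +_; 0ℤ; 1ℤ; -_; _-_; ∣_∣; _%ℕ_; _/ℕ_)
import Data.Integer.Properties as ℤ
open import Data.Integer.DivMod using (a≡a%ℕn+[a/ℕn]*n; n%ℕd<d)
open import Data.Integer.Divisibility.Signed
  using (_∣_; divides; ∣⇒∣ᵤ; ∣m⇒∣-m; ∣m∣n⇒∣m-n; ∣m∣n⇒∣m+n)
open import Data.Integer.Tactic.RingSolver using (solve-∀)
open import Data.Fin using (Fin; toℕ; fromℕ<)
open import Data.Fin.Properties using (toℕ<n; toℕ-fromℕ<)
open import Data.Maybe using (just)
open import Data.Product using (∃-syntax; _,_; proj₁; proj₂)
open import Data.Sum using (inj₁; inj₂)
open import Function using (_∘_; _$_)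
open import Relation.Nullary using (¬_; yes; no; contradiction)
open import Relation.Binary.PropositionalEquality
  using (_≡_; _≢_; refl; cong; subst; module ≡-Reasoning)
  renaming (sym to ≡-sym; trans to ≡-trans)

infix 4 _≡_[mod_]

record _≡_[mod_] (x y : ℤ) (k : ℕ) : Set where
  constructor mk≡[mod]
  field k∣x-y : + k ∣ x - y
open _≡_[mod_]

≡⇒≡[mod] : ∀ {k} {x y} → x ≡ y → x ≡ y [mod k ]
≡⇒≡[mod] x≡y = mk≡[mod] (divides 0ℤ (ℤ.i≡j⇒i-j≡0 x≡y))

%ℕ-≡[mod] : ∀ z k .{{_ : NonZero k}} → z ≡ + (z %ℕ k) [mod k ]
%ℕ-≡[mod] z k = mk≡[mod] (divides (z /ℕ k) (≡-trans (cong (_- r) (a≡a%ℕn+[a/ℕn]*n z k)) (cancel r _)))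
  where
  r : ℤ
  r = + (z %ℕ k)
  cancel : ∀ r m → (r ℤ.+ m) - r ≡ m
  cancel = solve-∀

∣∧∣∣<⇒≡0 : ∀ {k z} → + k ∣ z → ∣ z ∣ < k → z ≡ 0ℤ
∣∧∣∣<⇒≡0 {k} {z} k∣z ∣z∣<k with ∣ z ∣ in ∣z∣≡ | ∣⇒∣ᵤ k∣z
... | zero  | _     = ℤ.∣i∣≡0⇒i≡0 ∣z∣≡
... | suc _ | k∣∣z∣ = contradiction k∣∣z∣ (>⇒∤ ∣z∣<k)

∣⇒%ℕ≡0 : ∀ z k .{{_ : NonZero k}} → + k ∣ z → z %ℕ k ≡ 0
∣⇒%ℕ≡0 z k k∣z = ℤ.+-injective (∣∧∣∣<⇒≡0 k∣r (n%ℕd<d z k))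
  where
  r : ℤ
  r = + (z %ℕ k)
  k∣r : + k ∣ r
  k∣r = subst (+ k ∣_) (z-[z-r]≡r z r) (∣m∣n⇒∣m-n k∣z (k∣x-y (%ℕ-≡[mod] z k)))
    where
    z-[z-r]≡r : ∀ z r → z - (z - r) ≡ r
    z-[z-r]≡r = solve-∀

%ℕ≡0⇒∣ : ∀ z k .{{_ : NonZero k}} → z %ℕ k ≡ 0 → + k ∣ z
%ℕ≡0⇒∣ z k z%k≡0 =
  subst (+ k ∣_) (ℤ.+-identityʳ z) (subst (λ r → + k ∣ z - + r) z%k≡0 (k∣x-y (%ℕ-≡[mod] z k)))

absMod≥1⇒∤ : ∀ z k .{{_ : NonZero k}} → 1 ≤ absMod z k → ¬ (+ k ∣ z)
absMod≥1⇒∤ z k 1≤absMod k∣z = ℕ.n≮n 0 (subst (1 ≤_) (∣⇒%ℕ≡0 z k k∣z) 1≤rem)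
  where
  1≤rem : 1 ≤ rem z k
  1≤rem = ℕ.≤-trans 1≤absMod (ℕ.m⊓n≤m (rem z k) (rem (- z) k))

∤⇒absMod≥1 : ∀ z k .{{_ : NonZero k}} → ¬ (+ k ∣ z) → 1 ≤ absMod z k
∤⇒absMod≥1 z k k∤z = ℕ.⊓-glb (1≤rem z k∤z) (1≤rem (- z) (k∤z ∘ k∣-z⇒k∣z))
  where
  1≤rem : ∀ x → ¬ (+ k ∣ x) → 1 ≤ rem x k
  1≤rem x k∤x = ℕ.n≢0⇒n>0 (k∤x ∘ %ℕ≡0⇒∣ x k)
  k∣-z⇒k∣z : + k ∣ - z → + k ∣ z
  k∣-z⇒k∣z k∣-z = subst (+ k ∣_) (ℤ.neg-involutive z) (∣m⇒∣-m k∣-z)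

∣·∣ : ∀ s x → ∣ s · x ∣ ≡ ∣ x ∣
∣·∣ pos x = refl
∣·∣ neg x = ℤ.∣-i∣≡∣i∣ x

·-distribˡ-- : ∀ s x y → s · (x - y) ≡ s · x - s · y
·-distribˡ-- pos x y = refl
·-distribˡ-- neg x y = neg-distrib x y
  where
  neg-distrib : ∀ x y → - (x - y) ≡ - x - - y
  neg-distrib = solve-∀

∣⇒∣· : ∀ {k z} s → k ∣ z → k ∣ s · z
∣⇒∣· pos k∣z = k∣z
∣⇒∣· neg k∣z = ∣m⇒∣-m k∣z

∣-resp-≡[mod] : ∀ {k a b} → a ≡ b [mod k ] → + k ∣ b → + k ∣ a
∣-resp-≡[mod] {a = a} {b} (mk≡[mod] k∣a-b) k∣b = subst (_ ∣_) (a-b+b≡a a b) (∣m∣n⇒∣m+n k∣a-b k∣b)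
  where
  a-b+b≡a : ∀ a b → a - b ℤ.+ b ≡ a
  a-b+b≡a = solve-∀

≡[mod]-signedDiff : ∀ {k x x′ y y′} s → x ≡ x′ [mod k ] → y ≡ y′ [mod k ] →
                    x - s · y ≡ x′ - s · y′ [mod k ]
≡[mod]-signedDiff {x = x} {x′} {y} {y′} s (mk≡[mod] x≡x′) (mk≡[mod] y≡y′) =
  mk≡[mod] $ subst (_ ∣_) (≡-sym diff) (∣m∣n⇒∣m-n x≡x′ (∣⇒∣· s y≡y′))
  where
  open ≡-Reasoning
  rearrange : ∀ x x′ a b → x - a - (x′ - b) ≡ x - x′ - (a - b)
  rearrange = solve-∀
  diff : x - s · y - (x′ - s · y′) ≡ x - x′ - s · (y - y′)
  diff = begin
    x - s · y - (x′ - s · y′)   ≡⟨ rearrange x x′ (s · y) (s · y′) ⟩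
    x - x′ - (s · y - s · y′)   ≡⟨ cong (λ t → x - x′ - t) (·-distribˡ-- s y y′) ⟨
    x - x′ - s · (y - y′)       ∎

2*n≡n+n : ∀ n → 2 ℕ.* n ≡ n + n
2*n≡n+n n = cong (n ℕ.+_) (ℕ.+-identityʳ n)

m≤n⇒m+m≤2*n : ∀ {m n} → m ≤ n → m + m ≤ 2 ℕ.* n
m≤n⇒m+m≤2*n {m} {n} m≤n = subst (m + m ≤_) (≡-sym (2*n≡n+n n)) (ℕ.+-mono-≤ m≤n m≤n)

n≤1+⌊n/2⌋+⌊n/2⌋ : ∀ n → n ≤ suc (⌊ n /2⌋ + ⌊ n /2⌋)
n≤1+⌊n/2⌋+⌊n/2⌋ n = begin
  n                      ≡⟨ ℕ.⌊n/2⌋+⌈n/2⌉≡n n ⟨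
  ⌊ n /2⌋ + ⌈ n /2⌉      ≤⟨ ℕ.+-monoʳ-≤ ⌊ n /2⌋ (ℕ.⌊n/2⌋-mono (ℕ.n≤1+n (suc n))) ⟩
  ⌊ n /2⌋ + suc ⌊ n /2⌋  ≡⟨ ℕ.+-suc ⌊ n /2⌋ ⌊ n /2⌋ ⟩
  suc (⌊ n /2⌋ + ⌊ n /2⌋) ∎
  where open ℕ.≤-Reasoning

⌊n/2⌋+⌊n/2⌋≤n : ∀ n → ⌊ n /2⌋ + ⌊ n /2⌋ ≤ n
⌊n/2⌋+⌊n/2⌋≤n n = ℕ.≤-trans (ℕ.+-monoʳ-≤ ⌊ n /2⌋ (ℕ.⌊n/2⌋≤⌈n/2⌉ n)) (ℕ.≤-reflexive (ℕ.⌊n/2⌋+⌈n/2⌉≡n n))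

symmetricResidue : ∀ {k j a} → k ≤ suc (j + j) → a < k → ∃[ r ] (∣ r ∣ ≤ j × + a ≡ r [mod k ])
symmetricResidue {k} {j} {a} k≤1+2j a<k with a ℕ.≤? j
... | yes a≤j = + a , a≤j , ≡⇒≡[mod] refl
... | no  a≰j = + a - + k , ∣a-k∣≤j , mk≡[mod] (divides 1ℤ (a-[a-k]≡1*k (+ a) (+ k)))
  where
  a-[a-k]≡1*k : ∀ a k → a - (a - k) ≡ 1ℤ ℤ.* k
  a-[a-k]≡1*k = solve-∀
  open ℕ.≤-Reasoning
  ∣a-k∣≤j : ∣ + a - + k ∣ ≤ j
  ∣a-k∣≤j = begin
    ∣ + a - + k ∣        ≡⟨ cong ∣_∣ (ℤ.m-n≡m⊖n a k) ⟩
    ∣ a ℤ.⊖ k ∣          ≡⟨ ℤ.∣⊖∣-< a<k ⟩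
    k ∸ a                ≤⟨ ℕ.∸-mono k≤1+2j (ℕ.≰⇒> a≰j) ⟩
    suc (j + j) ∸ suc j  ≡⟨ ℕ.m+n∸n≡m j j ⟩
    j                    ∎

K1Coloring⇒signedColoring : ∀ G k → HasK1Coloring G k → ∃[ m ] (m ≤ suc k × HasSignedColoring G m)
K1Coloring⇒signedColoring G (suc k) (_ , c , c-proper) =
  suc (2 ℕ.* j) , s≤s 2j≤1+k , s≤s z≤n , c± , c±∈M , c±-proper
  where
  j : ℕ
  j = ⌊ suc k /2⌋
  2j≤1+k : 2 ℕ.* j ≤ suc k
  2j≤1+k = subst (_≤ suc k) (≡-sym (2*n≡n+n j)) (⌊n/2⌋+⌊n/2⌋≤n (suc k))
  residue : ∀ v → ∃[ r ] (∣ r ∣ ≤ j × + toℕ (c v) ≡ r [mod suc k ])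
  residue v = symmetricResidue (n≤1+⌊n/2⌋+⌊n/2⌋ (suc k)) (toℕ<n (c v))
  c± : Fin (n G) → ℤ
  c± v = proj₁ (residue v)
  c±∈M : ∀ v → InM (suc (2 ℕ.* j)) (c± v)
  c±∈M v = inj₁ (j , refl , proj₁ (proj₂ (residue v)))
  c±-proper : ∀ v w s → adj G v w ≡ just s → c± v ≢ s · c± w
  c±-proper v w s vw c±v≡s·c±w = absMod≥1⇒∤ _ (suc k) (c-proper v w s vw) k∣c-diff
    where
    k∣c-diff : + suc k ∣ + toℕ (c v) - s · (+ toℕ (c w))
    k∣c-diff = ∣-resp-≡[mod]
      (≡[mod]-signedDiff s (proj₂ (proj₂ (residue v))) (proj₂ (proj₂ (residue w))))
      (k∣x-y (≡⇒≡[mod] c±v≡s·c±w))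

InM⇒∣x∣+∣x∣≤m : ∀ {m x} → InM m x → ∣ x ∣ + ∣ x ∣ ≤ m
InM⇒∣x∣+∣x∣≤m (inj₁ (j , refl , ∣x∣≤j))     = ℕ.m≤n⇒m≤1+n (m≤n⇒m+m≤2*n ∣x∣≤j)
InM⇒∣x∣+∣x∣≤m (inj₂ (j , refl , _ , ∣x∣≤j)) = m≤n⇒m+m≤2*n ∣x∣≤j

m+m≤o⇒n+n≤o⇒m+n≤o : ∀ m n {o} → m + m ≤ o → n + n ≤ o → m + n ≤ o
m+m≤o⇒n+n≤o⇒m+n≤o m n m+m≤o n+n≤o with ℕ.≤-total m n
... | inj₁ m≤n = ℕ.≤-trans (ℕ.+-monoˡ-≤ n m≤n) n+n≤o
... | inj₂ n≤m = ℕ.≤-trans (ℕ.+-monoʳ-≤ m n≤m) m+m≤o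

∣signedDiff∣≤m : ∀ {m x y} s → InM m x → InM m y → ∣ x - s · y ∣ ≤ m
∣signedDiff∣≤m {m} {x} {y} s x∈M y∈M = begin
  ∣ x - s · y ∣          ≤⟨ ℤ.∣i-j∣≤∣i∣+∣j∣ x (s · y) ⟩
  ∣ x ∣ + ∣ s · y ∣      ≡⟨ cong (∣ x ∣ ℕ.+_) (∣·∣ s y) ⟩
  ∣ x ∣ + ∣ y ∣          ≤⟨ m+m≤o⇒n+n≤o⇒m+n≤o ∣ x ∣ ∣ y ∣ (InM⇒∣x∣+∣x∣≤m x∈M) (InM⇒∣x∣+∣x∣≤m y∈M) ⟩
  m                      ∎
  where open ℕ.≤-Reasoning

signedColoring⇒K1Coloring : ∀ G m → HasSignedColoring G m → HasK1Coloring G (suc m)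
signedColoring⇒K1Coloring G m (1≤m , c , c∈M , c-proper) = s≤s 1≤m , c′ , c′-proper
  where
  c′ : Fin (n G) → Fin (suc m)
  c′ v = fromℕ< (n%ℕd<d (c v) (suc m))
  c′-proper : IsKDColoring G (suc m) 1 c′
  c′-proper v w s vw
    rewrite toℕ-fromℕ< (n%ℕd<d (c v) (suc m)) | toℕ-fromℕ< (n%ℕd<d (c w) (suc m)) =
    ∤⇒absMod≥1 _ (suc m) (c-proper v w s vw ∘ ℤ.i-j≡0⇒i≡j _ _ ∘ c-diff≡0)
    where
    c-diff≡0 : + suc m ∣ + (c v %ℕ suc m) - s · (+ (c w %ℕ suc m)) → c v - s · c w ≡ 0ℤ
    c-diff≡0 k∣residue-diff = ∣∧∣∣<⇒≡0
      (∣-resp-≡[mod] (≡[mod]-signedDiff s (%ℕ-≡[mod] (c v) (suc m)) (%ℕ-≡[mod] (c w) (suc m)))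
                     k∣residue-diff)
      (s≤s (∣signedDiff∣≤m s (c∈M v) (c∈M w)))

proposition21 : (G : SignedGraph) (χ χ± : ℕ) →
    IsChromaticNumber G χ → IsSignedChromaticNumber G χ± →
    (χ± ≤ χ + 1) × (χ ≤ χ± + 1)
proposition21 G χ χ± (hasχ , χ-least) (hasχ± , χ±-least)
  with K1Coloring⇒signedColoring G χ hasχ
... | m , m≤1+χ , has-m =
  ℕ.≤-trans (χ±-least m has-m) (ℕ.≤-trans m≤1+χ (ℕ.≤-reflexive (ℕ.+-comm 1 χ))) ,
  subst (χ ≤_) (ℕ.+-comm 1 χ±) (χ-least (suc χ±) (signedColoring⇒K1Coloring G χ± hasχ±))
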